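{- Let $d\ge 2$ and $s\ge 3$ be integers and let $G$ be a $\{K_{1,d},P_s\}$-free graph. Then $\mathsf{tree}\text{ - }\alpha(G)\le (d-1)(s-2)$.
   Context: Graphs are finite and simple; $G$ is $\{H_1,H_2\}$-free if it has no induced subgraph isomorphic to $H_1$ or $H_2$. $K_{1,d}$ is the star with $d$ leaves and $P_s$ is the path on $s$ vertices. A tree decomposition of $G$ is a pair $(T,\beta)$ with $T$ a tree and $\beta:V(T)\to 2^{V(G)}$ such that every vertex lies in some bag, every edge has both endpoints in some bag, and for each vertex the nodes whose bags contain it induce a subtree. Its independence number is $\max_t \alpha(G[\beta(t)])$; $\mathsf{tree}\text{ - }\alpha(G)$ is the minimum independence number over all tree decompositions of $G$. -}

module Defs where

open import Data.Nat using (ℕ; zero; suc; _≡ᵇ_)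

open import Data.Bool using (Bool; true; false; _∨_)
open import Data.Bool.Properties using (∨-comm)
open import Data.Fin using (Fin; zero; suc; toℕ; fromℕ)
open import Data.Fin.Subset using (Subset; _∈_; _⊆_; ∣_∣)
open import Data.Product using (Σ; ∃; _×_; _,_)
open import Data.Empty using (⊥)
open import Relation.Nullary using (¬_)
open import Relation.Binary.PropositionalEquality using (_≡_; refl)
open import Function.Definitions using (Injective)

record Graph (n : ℕ) : Set where
  field
    adj    : Fin n → Fin n → Bool
    sym    : ∀ u v → adj u v ≡ adj v u
    irrefl : ∀ v → adj v v ≡ false
open Graph public

InducedSubgraph : ∀ {k n} → Graph k → Graph n → Set
InducedSubgraph {k} {n} H G =
  Σ (Fin k → Fin n) λ f → Injective _≡_ _≡_ f × (∀ i j → adj G (f i) (f j) ≡ adj H i j)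

Free : ∀ {k n} → Graph k → Graph n → Set
Free H G = ¬ InducedSubgraph H G

starAdj : ∀ {d} → Fin (suc d) → Fin (suc d) → Bool
starAdj zero    zero    = false
starAdj zero    (suc _) = true
starAdj (suc _) zero    = true
starAdj (suc _) (suc _) = false

star : (d : ℕ) → Graph (suc d)
star d = record { adj = starAdj ; sym = s ; irrefl = i }
  where
  s : ∀ u v → starAdj u v ≡ starAdj v u
  s zero zero = refl
  s zero (suc _) = refl
  s (suc _) zero = refl
  s (suc _) (suc _) = refl
  i : ∀ v → starAdj v v ≡ false
  i zero = refl
  i (suc _) = refl

pathAdj : ∀ {s} → Fin s → Fin s → Bool
pathAdj i j = (toℕ j ≡ᵇ suc (toℕ i)) ∨ (toℕ i ≡ᵇ suc (toℕ j))

private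
  ≡ᵇ-suc-false : ∀ m → (m ≡ᵇ suc m) ≡ false
  ≡ᵇ-suc-false zero = refl
  ≡ᵇ-suc-false (suc m) = ≡ᵇ-suc-false m

path : (s : ℕ) → Graph s
path s = record
  { adj = pathAdj
  ; sym = λ u v → ∨-comm (toℕ v ≡ᵇ suc (toℕ u)) (toℕ u ≡ᵇ suc (toℕ v))
  ; irrefl = λ v → irr (toℕ v) }
  where
  irr : ∀ m → ((m ≡ᵇ suc m) ∨ (m ≡ᵇ suc m)) ≡ false
  irr m rewrite ≡ᵇ-suc-false m = refl

data WalkIn {n} (G : Graph n) (P : Fin n → Set) : Fin n → Fin n → Set where
  here : ∀ {u} → P u → WalkIn G P u u
  step : ∀ {u w v} → P u → adj G u w ≡ true → WalkIn G P w v → WalkIn G P u v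

InducesConnected : ∀ {n} → Graph n → (Fin n → Set) → Set
InducesConnected G P = ∀ u v → P u → P v → WalkIn G P u v

Connected : ∀ {n} → Graph n → Set
Connected {n} G = ∀ (u v : Fin n) → WalkIn G (λ _ → Data.Unit.⊤) u v
  where import Data.Unit

Cycle : ∀ {n} → Graph n → Set
Cycle {n} G =
  Σ ℕ λ k → Σ (Fin (suc (suc (suc k))) → Fin n) λ c →
    Injective _≡_ _≡_ c
    × (∀ i j → toℕ j ≡ suc (toℕ i) → adj G (c i) (c j) ≡ true)
    × (adj G (c (fromℕ (suc (suc k)))) (c zero) ≡ true)

Acyclic : ∀ {n} → Graph n → Set
Acyclic G = ¬ Cycle G

record IsTree {m} (T : Graph m) : Set where
  field
    nonempty  : Fin m
    connected : Connected T
    acyclic   : Acyclic T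

record TreeDecomposition {n} (G : Graph n) : Set where
  field
    m       : ℕ
    T       : Graph m
    isTree  : IsTree T
    β       : Fin m → Subset n
    cover   : ∀ v → ∃ λ t → v ∈ β t
    edgeCov : ∀ u v → adj G u v ≡ true → ∃ λ t → u ∈ β t × v ∈ β t
    subtree : ∀ v → InducesConnected T (λ t → v ∈ β t)
open TreeDecomposition public

Independent : ∀ {n} → Graph n → Subset n → Set
Independent G S = ∀ u v → u ∈ S → v ∈ S → adj G u v ≡ false

-- α(G[B]) ≤ k : every independent set of G contained in B has size ≤ k
-- (independent sets of G[B] are exactly the independent sets of G inside B).
IndepNumAtMost : ∀ {n} → Graph n → Subset n → ℕ → Set
IndepNumAtMost G B k = ∀ S → S ⊆ B → Independent G S → ∣ S ∣ Data.Nat.≤ k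
  where import Data.Nat

TreeAlphaAtMost : ∀ {n} → Graph n → ℕ → Set
TreeAlphaAtMost G k =
  Σ (TreeDecomposition G) λ D → ∀ t → IndepNumAtMost G (β D t) k

module Submission where

-- The decomposition is a path decomposition in which every bag lies in the union of the closed
-- neighbourhoods of an induced path on at most s - 2 vertices; by K_{1,d}-freeness each closed
-- neighbourhood has independence number at most d - 1. It is built recursively. A set C that
-- hangs from the end q₀ of an induced path q (C misses the closed neighbourhoods of the other
-- path vertices and reaches N[q₀] inside itself) puts N[q₀] ∩ C into all of its bags, followed
-- by the decompositions of the components K of C - N[q₀], laid out one after another. Each such
-- K is joined by an edge zw to a neighbour w ∈ C of q₀, so K hangs from the longer induced path
-- w q; as z w q is induced too, P_s-freeness keeps w q within s - 2 vertices.

open import Defs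
open import Data.Nat
  using (ℕ; zero; suc; pred; _+_; _*_; _∸_; _≤_; _<_; z≤n; s≤s; _≤?_; _<?_; _≤ᵇ_; _≡ᵇ_)
open import Data.Nat.Properties
open import Data.Nat.DivMod using (_mod_; m<n⇒m%n≡m; n%n≡0)
open import Data.Nat.Induction using (<-wellFounded)
open import Data.Bool using (Bool; true; false; _∧_; _∨_; if_then_else_)
import Data.Bool.Properties as Boolₚ
open import Data.Fin using (Fin; zero; suc; toℕ; fromℕ<; inject≤)
import Data.Fin.Properties as Finₚ
open import Data.Fin.Subset
  using (Subset; _∈_; _∉_; _⊆_; _⊂_; ∣_∣; _∩_; _∪_; _─_; ⁅_⁆; Empty) renaming (⊥ to ∅; ⊤ to 𝕍)
open import Data.Fin.Subset.Properties
open import Data.Vec using ([]; _∷_; tabulate; here; there)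
import Data.Vec.Properties as Vecₚ
open import Data.Vec.Functional as Vector using (Vector) renaming (_∷_ to _◂_)
open import Data.Product using (∃; ∃₂; _×_; _,_; proj₁; proj₂)
open import Data.Sum using (_⊎_; inj₁; inj₂; map₁)
open import Data.Empty using (⊥-elim)
import Data.Unit as Unit
open import Function using (_∘_; id; Equivalence)
open import Function.Definitions using (Injective)
open import Induction.WellFounded using (Acc; acc)
open import Relation.Nullary using (¬_; yes; no; does; contradiction)
open import Relation.Nullary.Decidable using (_×-dec_)
open import Relation.Binary.PropositionalEquality as ≡
  using (_≡_; _≢_; refl; trans; cong; cong₂; subst)

private
  variable
    n : ℕ

∈-tabulate⁺ : ∀ {f : Fin n → Bool} {x} → f x ≡ true → x ∈ tabulate f
∈-tabulate⁺ {f = f} {x} fx = Vecₚ.lookup⇒[]= x (tabulate f) (trans (Vecₚ.lookup∘tabulate f x) fx)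

∈-tabulate⁻ : ∀ {f : Fin n → Bool} {x} → x ∈ tabulate f → f x ≡ true
∈-tabulate⁻ {f = f} {x} x∈ = trans (≡.sym (Vecₚ.lookup∘tabulate f x)) (Vecₚ.[]=⇒lookup x∈)

x∈p─q⁻ : ∀ (p q : Subset n) {x} → x ∈ p ─ q → x ∈ p × x ∉ q
x∈p─q⁻ (true ∷ p) (false ∷ q) {zero} here = here , λ ()
x∈p─q⁻ (true ∷ p) (true ∷ q) {zero} ()
x∈p─q⁻ (false ∷ p) (true ∷ q) {zero} ()
x∈p─q⁻ (false ∷ p) (false ∷ q) {zero} ()
x∈p─q⁻ (_ ∷ p) (_ ∷ q) {suc x} (there x∈p─q) with x∈p─q⁻ p q x∈p─q
... | x∈p , x∉q = there x∈p , λ { (there x∈q) → x∉q x∈q }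

∣p∣≤∣p∩q∣+∣p─q∣ : ∀ (p q : Subset n) → ∣ p ∣ ≤ ∣ p ∩ q ∣ + ∣ p ─ q ∣
∣p∣≤∣p∩q∣+∣p─q∣ [] [] = z≤n
∣p∣≤∣p∩q∣+∣p─q∣ (true ∷ p) (true ∷ q) = s≤s (∣p∣≤∣p∩q∣+∣p─q∣ p q)
∣p∣≤∣p∩q∣+∣p─q∣ (true ∷ p) (false ∷ q) =
  subst (suc ∣ p ∣ ≤_) (≡.sym (+-suc _ _)) (s≤s (∣p∣≤∣p∩q∣+∣p─q∣ p q))
∣p∣≤∣p∩q∣+∣p─q∣ (false ∷ p) (true ∷ q) = ∣p∣≤∣p∩q∣+∣p─q∣ p q
∣p∣≤∣p∩q∣+∣p─q∣ (false ∷ p) (false ∷ q) = ∣p∣≤∣p∩q∣+∣p─q∣ p q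

enumerate : (p : Subset n) → Fin ∣ p ∣ → Fin n
enumerate (true ∷ p) zero = zero
enumerate (true ∷ p) (suc i) = suc (enumerate p i)
enumerate (false ∷ p) i = suc (enumerate p i)

enumerate-∈ : ∀ (p : Subset n) i → enumerate p i ∈ p
enumerate-∈ (true ∷ p) zero = here
enumerate-∈ (true ∷ p) (suc i) = there (enumerate-∈ p i)
enumerate-∈ (false ∷ p) i = there (enumerate-∈ p i)

enumerate-injective : ∀ (p : Subset n) → Injective _≡_ _≡_ (enumerate p)
enumerate-injective (true ∷ p) {zero} {zero} _ = refl
enumerate-injective (true ∷ p) {suc i} {suc j} e =
  cong suc (enumerate-injective p (Finₚ.suc-injective e))
enumerate-injective (false ∷ p) e = enumerate-injective p (Finₚ.suc-injective e)

module _ {G : Graph n} where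

  walk-map : ∀ {P Q : Fin n → Set} {u v} → (∀ {x} → P x → Q x) → WalkIn G P u v → WalkIn G Q u v
  walk-map P⇒Q (here pu) = here (P⇒Q pu)
  walk-map P⇒Q (step pu a w) = step (P⇒Q pu) a (walk-map P⇒Q w)

  walk-source : ∀ {P : Fin n → Set} {u v} → WalkIn G P u v → P u
  walk-source (here pu) = pu
  walk-source (step pu _ _) = pu

  walk-target : ∀ {P : Fin n → Set} {u v} → WalkIn G P u v → P v
  walk-target (here pv) = pv
  walk-target (step _ _ w) = walk-target w

  _++ʷ_ : ∀ {P : Fin n → Set} {u v w} → WalkIn G P u v → WalkIn G P v w → WalkIn G P u w
  here _ ++ʷ w₂ = w₂
  step pu a w₁ ++ʷ w₂ = step pu a (w₁ ++ʷ w₂)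

  walk-reverse : ∀ {P : Fin n → Set} {u v} → WalkIn G P u v → WalkIn G P v u
  walk-reverse (here pu) = here pu
  walk-reverse (step pu a w) =
    walk-reverse w ++ʷ step (walk-source w) (trans (sym G _ _) a) (here pu)

  walk-stays : ∀ {P Q : Fin n → Set} {u v} → (∀ {x y} → Q x → P y → adj G x y ≡ true → Q y) →
               Q u → WalkIn G P u v → WalkIn G Q u v
  walk-stays closed qu (here _) = here qu
  walk-stays closed qu (step _ a w) = step qu a (walk-stays closed (closed qu (walk-source w) a) w)

  walk-exit : ∀ {P : Fin n → Set} (X : Subset n) {u v} → u ∉ X → v ∈ X → WalkIn G P u v →
              ∃₂ λ y z → y ∈ X × P y × adj G z y ≡ true × WalkIn G (λ x → P x × x ∉ X) u z
  walk-exit X u∉X v∈X (here _) = contradiction v∈X u∉X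
  walk-exit X {u} u∉X v∈X (step {w = w} pu a rest) with w ∈? X
  ... | yes w∈X = w , u , w∈X , walk-source rest , a , here (pu , u∉X)
  ... | no w∉X with walk-exit X w∉X v∈X rest
  ...   | y , z , y∈X , py , z~y , prefix = y , z , y∈X , py , z~y , step (pu , u∉X) a prefix

UnitStep : ℕ → ℕ → Set
UnitStep x y = y ≡ suc x ⊎ x ≡ suc y

module _ (f : ℕ → ℕ) (m : ℕ)
         (unit : ∀ i → i < m → UnitStep (f i) (f (suc i)))
         (no-backtrack : ∀ i → 2 + i ≤ m → f (2 + i) ≢ f i) where

  private
    keeps-ascending : f 1 ≡ suc (f 0) → ∀ i → i < m → f (suc i) ≡ suc (f i)
    keeps-ascending up zero _ = up
    keeps-ascending up (suc i) i+1<m with unit (suc i) i+1<m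
    ... | inj₁ step-up = step-up
    ... | inj₂ step-down = contradiction
      (suc-injective (trans (≡.sym step-down) (keeps-ascending up i (<⇒≤ i+1<m))))
      (no-backtrack i i+1<m)

    keeps-descending : f 0 ≡ suc (f 1) → ∀ i → i < m → f i ≡ suc (f (suc i))
    keeps-descending down zero _ = down
    keeps-descending down (suc i) i+1<m with unit (suc i) i+1<m
    ... | inj₂ step-down = step-down
    ... | inj₁ step-up = contradiction
      (trans step-up (≡.sym (keeps-descending down i (<⇒≤ i+1<m))))
      (no-backtrack i i+1<m)

    ascent : (∀ i → i < m → f (suc i) ≡ suc (f i)) → ∀ i → i ≤ m → f i ≡ i + f 0
    ascent up zero _ = refl
    ascent up (suc i) i<m = trans (up i i<m) (cong suc (ascent up i (<⇒≤ i<m)))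

    descent : (∀ i → i < m → f i ≡ suc (f (suc i))) → ∀ i → i ≤ m → f 0 ≡ i + f i
    descent down zero _ = refl
    descent down (suc i) i<m =
      trans (descent down i (<⇒≤ i<m)) (trans (cong (i +_) (down i i<m)) (+-suc i _))

  non-backtracking⇒fm≢f0 : 0 < m → f m ≢ f 0
  non-backtracking⇒fm≢f0 0<m fm≡f0 = <⇒≢ (m<n+m (f 0) 0<m) f0≡m+f0
    where
    f0≡m+f0 : f 0 ≡ m + f 0
    f0≡m+f0 with unit 0 0<m
    ... | inj₁ up = trans (≡.sym fm≡f0) (ascent (keeps-ascending up) m ≤-refl)
    ... | inj₂ down = trans (descent (keeps-descending down) m ≤-refl) (cong (m +_) fm≡f0)

path-adjacent⇒unit-step : ∀ {m} {u v : Fin m} → adj (path m) u v ≡ true → UnitStep (toℕ u) (toℕ v)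
path-adjacent⇒unit-step {u = u} {v} uv
  with Equivalence.to Boolₚ.T-∨ (Equivalence.from Boolₚ.T-≡ uv)
... | inj₁ up = inj₁ (≡ᵇ⇒≡ (toℕ v) (suc (toℕ u)) up)
... | inj₂ down = inj₂ (≡ᵇ⇒≡ (toℕ u) (suc (toℕ v)) down)

successor⇒path-adjacent : ∀ {m} {u v : Fin m} → toℕ v ≡ suc (toℕ u) → adj (path m) u v ≡ true
successor⇒path-adjacent {u = u} {v} v≡1+u =
  Equivalence.to Boolₚ.T-≡ (Equivalence.from Boolₚ.T-∨ (inj₁ (≡⇒≡ᵇ (toℕ v) (suc (toℕ u)) v≡1+u)))

module _ {m} (P : Fin m → Set)
         (convex : ∀ {i j k} → toℕ i ≤ toℕ j → toℕ j ≤ toℕ k → P i → P k → P j) where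

  private
    ascending-walk : ∀ g {u v} → toℕ v ≡ g + toℕ u → P u → P v → WalkIn (path m) P u v
    ascending-walk zero {u} v≡u pu _ with Finₚ.toℕ-injective v≡u
    ... | refl = here pu
    ascending-walk (suc g) {u} {v} v≡1+g+u pu pv =
      step pu (successor⇒path-adjacent u'≡1+u) (ascending-walk g v≡g+u' pu' pv)
      where
      1+u≤v : suc (toℕ u) ≤ toℕ v
      1+u≤v = ≤-trans (s≤s (m≤n+m (toℕ u) g)) (≤-reflexive (≡.sym v≡1+g+u))
      u' : Fin m
      u' = fromℕ< (<-≤-trans (s≤s 1+u≤v) (Finₚ.toℕ<n v))
      u'≡1+u : toℕ u' ≡ suc (toℕ u)
      u'≡1+u = Finₚ.toℕ-fromℕ< _
      v≡g+u' : toℕ v ≡ g + toℕ u'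
      v≡g+u' = trans v≡1+g+u (trans (≡.sym (+-suc g (toℕ u))) (cong (g +_) (≡.sym u'≡1+u)))
      pu' : P u'
      pu' = convex (≤-trans (n≤1+n _) (≤-reflexive (≡.sym u'≡1+u)))
                   (≤-trans (≤-reflexive u'≡1+u) 1+u≤v) pu pv

  convex⇒connected : InducesConnected (path m) P
  convex⇒connected u v pu pv with toℕ u ≤? toℕ v
  ... | yes u≤v = ascending-walk (toℕ v ∸ toℕ u) (≡.sym (m∸n+n≡m u≤v)) pu pv
  ... | no u≰v =
    walk-reverse (ascending-walk (toℕ u ∸ toℕ v) (≡.sym (m∸n+n≡m (<⇒≤ (≰⇒> u≰v)))) pv pu)

path-acyclic : ∀ {m} → Acyclic (path m)
path-acyclic {m} (k , c , c-injective , consecutive , closing) =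
  non-backtracking⇒fm≢f0 f L unit no-backtrack (s≤s z≤n) fL≡f0
  where
  L : ℕ
  L = 3 + k
  -- Indices are taken mod L, so the closing edge is the step from position L - 1 to L.
  pos : ℕ → Fin L
  pos i = i mod L
  toℕ-pos : ∀ {i} → i < L → toℕ (pos i) ≡ i
  toℕ-pos i<L = trans (Finₚ.toℕ-fromℕ< _) (m<n⇒m%n≡m i<L)
  pos-L : pos L ≡ zero
  pos-L = Finₚ.toℕ-injective (trans (Finₚ.toℕ-fromℕ< _) (n%n≡0 L))
  f : ℕ → ℕ
  f i = toℕ (c (pos i))
  fL≡f0 : f L ≡ f 0
  fL≡f0 = cong (toℕ ∘ c) (trans pos-L (≡.sym (Finₚ.toℕ-injective (toℕ-pos {0} (s≤s z≤n)))))
  unit : ∀ i → i < L → UnitStep (f i) (f (suc i))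
  unit i i<L with m≤n⇒m<n∨m≡n i<L
  ... | inj₁ 1+i<L = path-adjacent⇒unit-step
          (consecutive (pos i) (pos (suc i))
            (trans (toℕ-pos 1+i<L) (cong suc (≡.sym (toℕ-pos i<L)))))
  ... | inj₂ refl = path-adjacent⇒unit-step
          (≡.subst₂ (λ a b → adj (path m) (c a) (c b) ≡ true)
            (Finₚ.toℕ-injective (trans (Finₚ.toℕ-fromℕ _) (≡.sym (toℕ-pos i<L))))
            (≡.sym pos-L) closing)
  pos-2+i≢pos-i : ∀ i → 2 + i ≤ L → toℕ (pos (2 + i)) ≢ toℕ (pos i)
  pos-2+i≢pos-i i 2+i≤L with m≤n⇒m<n∨m≡n 2+i≤L
  ... | inj₁ 2+i<L rewrite toℕ-pos 2+i<L | toℕ-pos (<⇒≤ (<⇒≤ 2+i<L)) =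
    <⇒≢ (m<n+m i (s≤s z≤n)) ∘ ≡.sym
  ... | inj₂ refl rewrite cong toℕ pos-L | toℕ-pos {i} (m<n⇒m<1+n (n<1+n _)) = λ ()
  no-backtrack : ∀ i → 2 + i ≤ L → f (2 + i) ≢ f i
  no-backtrack i 2+i≤L = pos-2+i≢pos-i i 2+i≤L ∘ cong toℕ ∘ c-injective ∘ Finₚ.toℕ-injective

path-isTree : ∀ m → IsTree (path (suc m))
path-isTree m = record
  { nonempty  = zero
  ; connected = λ u v → convex⇒connected (λ _ → Unit.⊤) (λ _ _ _ _ → _) u v _ _
  ; acyclic   = path-acyclic
  }

path-free⇒longer-path-free : ∀ {s m} {G : Graph n} → s ≤ m → Free (path s) G → Free (path m) G
path-free⇒longer-path-free {s = s} {m} {G} s≤m Ps-free (f , f-injective , f-adj) =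
  Ps-free (f ∘ shrink , shrink-injective , shrink-adj)
  where
  shrink : Fin s → Fin m
  shrink i = inject≤ i s≤m
  shrink-injective : Injective _≡_ _≡_ (f ∘ shrink)
  shrink-injective e = Finₚ.inject≤-injective _ _ _ _ (f-injective e)
  shrink-adj : ∀ i j → adj G (f (shrink i)) (f (shrink j)) ≡ adj (path s) i j
  shrink-adj i j = trans (f-adj (shrink i) (shrink j))
    (cong₂ (λ a b → (b ≡ᵇ suc a) ∨ (a ≡ᵇ suc b)) (Finₚ.toℕ-inject≤ i s≤m) (Finₚ.toℕ-inject≤ j s≤m))

module _ (G : Graph n) where

  infix 4 _~_
  _~_ : Fin n → Fin n → Set
  x ~ y = adj G x y ≡ true

  ~-sym : ∀ {x y} → x ~ y → y ~ x
  ~-sym {x} {y} x~y = trans (sym G y x) x~y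

  ~-irrefl : ∀ {x} → ¬ x ~ x
  ~-irrefl {x} x~x with trans (≡.sym x~x) (irrefl G x)
  ... | ()

  nbhd : Fin n → Subset n
  nbhd p = tabulate (adj G p)

  N[_] : Fin n → Subset n
  N[ p ] = ⁅ p ⁆ ∪ nbhd p

  p∈N[p] : ∀ p → p ∈ N[ p ]
  p∈N[p] p = x∈p∪q⁺ (inj₁ (x∈⁅x⁆ p))

  ~⇒∈N[] : ∀ {p x} → p ~ x → x ∈ N[ p ]
  ~⇒∈N[] p~x = x∈p∪q⁺ (inj₂ (∈-tabulate⁺ p~x))

  ∈N[]⁻ : ∀ {p x} → x ∈ N[ p ] → x ≡ p ⊎ p ~ x
  ∈N[]⁻ {p} x∈N[p] with x∈p∪q⁻ ⁅ p ⁆ (nbhd p) x∈N[p]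
  ... | inj₁ x∈⁅p⁆ = inj₁ (x∈⁅y⁆⇒x≡y p x∈⁅p⁆)
  ... | inj₂ x∈nbhd = inj₂ (∈-tabulate⁻ x∈nbhd)

  pathNbhd : ∀ {m} → Vector (Fin n) m → Subset n
  pathNbhd {zero} q = ∅
  pathNbhd {suc m} q = N[ q zero ] ∪ pathNbhd (Vector.tail q)

  α≤ : (Fin n → Set) → ℕ → Set
  α≤ P k = ∀ S → (∀ {x} → x ∈ S → P x) → Independent G S → ∣ S ∣ ≤ k

  independent-⊆ : ∀ {S T} → T ⊆ S → Independent G S → Independent G T
  independent-⊆ T⊆S S-indep u v u∈T v∈T = S-indep u v (T⊆S u∈T) (T⊆S v∈T)

  independent⇒≁ : ∀ {S u v} → Independent G S → u ∈ S → v ∈ S → ¬ u ~ v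
  independent⇒≁ S-indep u∈S v∈S u~v with trans (≡.sym u~v) (S-indep _ _ u∈S v∈S)
  ... | ()

  α≤-mono : ∀ {P Q : Fin n → Set} {k k′} → (∀ {x} → P x → Q x) → k ≤ k′ → α≤ Q k → α≤ P k′
  α≤-mono P⇒Q k≤k′ α≤Q S S⊆P S-indep = ≤-trans (α≤Q S (P⇒Q ∘ S⊆P) S-indep) k≤k′

  α≤-∅ : α≤ (_∈ ∅) 0
  α≤-∅ S S⊆∅ _ = ≤-trans (p⊆q⇒∣p∣≤∣q∣ S⊆∅) (≤-reflexive (∣⊥∣≡0 n))

  α≤-∪ : ∀ {A B a b} → α≤ (_∈ A) a → α≤ (_∈ B) b → α≤ (_∈ A ∪ B) (a + b)
  α≤-∪ {A} {B} α≤A α≤B S S⊆A∪B S-indep = ≤-trans (∣p∣≤∣p∩q∣+∣p─q∣ S A) (+-mono-≤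
    (α≤A (S ∩ A) (proj₂ ∘ x∈p∩q⁻ S A) (independent-⊆ (p∩q⊆p S A) S-indep))
    (α≤B (S ─ A) S─A⊆B (independent-⊆ (p─q⊆p S A) S-indep)))
    where
    S─A⊆B : S ─ A ⊆ B
    S─A⊆B x∈S─A with x∈p─q⁻ S A x∈S─A
    ... | x∈S , x∉A with x∈p∪q⁻ A B (S⊆A∪B x∈S)
    ...   | inj₁ x∈A = contradiction x∈A x∉A
    ...   | inj₂ x∈B = x∈B

  IsInducedPath : ∀ {m} → Vector (Fin n) m → Set
  IsInducedPath {m} q = Injective _≡_ _≡_ q × (∀ i j → adj G (q i) (q j) ≡ adj (path m) i j)

  single-vertex-path : ∀ x → IsInducedPath (x ◂ Vector.[])
  single-vertex-path x = (λ { {zero} {zero} _ → refl }) , λ { zero zero → irrefl G x }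

  ◂-induced : ∀ {k w} {q : Vector (Fin n) (suc k)} → IsInducedPath q → w ~ q zero →
           (∀ i → w ∉ N[ q (suc i) ]) → IsInducedPath (w ◂ q)
  ◂-induced {k} {w} {q} (q-injective , q-adj) w~q₀ far = injective , adjacency
    where
    w≢q : ∀ i → w ≢ q i
    w≢q zero w≡q₀ = ~-irrefl (subst (_~ q zero) w≡q₀ w~q₀)
    w≢q (suc i) w≡q = far i (subst (_∈ N[ q (suc i) ]) (≡.sym w≡q) (p∈N[p] _))
    w≁q : ∀ i → adj G w (q (suc i)) ≡ false
    w≁q i = Boolₚ.¬-not (λ w~q → far i (~⇒∈N[] (~-sym w~q)))
    injective : Injective _≡_ _≡_ (w ◂ q)
    injective {zero} {zero} _ = refl
    injective {zero} {suc j} e = contradiction e (w≢q j)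
    injective {suc i} {zero} e = contradiction (≡.sym e) (w≢q i)
    injective {suc i} {suc j} e = cong suc (q-injective e)
    adjacency : ∀ i j → adj G ((w ◂ q) i) ((w ◂ q) j) ≡ adj (path (suc (suc k))) i j
    adjacency zero zero = irrefl G w
    adjacency zero (suc zero) = w~q₀
    adjacency zero (suc (suc j)) = w≁q j
    adjacency (suc zero) zero = ~-sym w~q₀
    adjacency (suc (suc i)) zero = trans (sym G _ w) (w≁q i)
    adjacency (suc i) (suc j) = q-adj i j

  Closed : Subset n → Subset n → Set
  Closed U K = ∀ {a b} → a ∈ K → b ∈ U → a ~ b → b ∈ K

  record Component (U K : Subset n) : Set where
    field
      root    : Fin n
      root∈K  : root ∈ K
      K⊆U     : K ⊆ U
      closed  : Closed U K
      to-root : ∀ {a} → a ∈ K → WalkIn G (_∈ K) a root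

  component : ∀ {R x} → x ∈ R → ∃ (Component R)
  component {R} {x} x∈R = grow ⁅ x ⁆ (<-wellFounded _) ⁅x⁆⊆R (x∈⁅x⁆ x) ⁅x⁆-to-x
    where
    ⁅x⁆⊆R : ⁅ x ⁆ ⊆ R
    ⁅x⁆⊆R a∈⁅x⁆ = subst (_∈ R) (≡.sym (x∈⁅y⁆⇒x≡y x a∈⁅x⁆)) x∈R
    ⁅x⁆-to-x : ∀ {a} → a ∈ ⁅ x ⁆ → WalkIn G (_∈ ⁅ x ⁆) a x
    ⁅x⁆-to-x a∈⁅x⁆ with x∈⁅y⁆⇒x≡y x a∈⁅x⁆
    ... | refl = here a∈⁅x⁆
    grow : ∀ K → Acc _<_ ∣ R ─ K ∣ → K ⊆ R → x ∈ K → (∀ {a} → a ∈ K → WalkIn G (_∈ K) a x) →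
           ∃ (Component R)
    grow K (acc smaller) K⊆R x∈K to-x
      with Finₚ.any? (λ b → b ∈? R ─ K ×-dec Finₚ.any? (λ a → a ∈? K ×-dec adj G a b Boolₚ.≟ true))
    ... | no no-edge-leaves = K , record
      { root = x ; root∈K = x∈K ; K⊆U = K⊆R ; closed = closed ; to-root = to-x }
      where
      closed : Closed R K
      closed {a} {b} a∈K b∈R a~b with b ∈? K
      ... | yes b∈K = b∈K
      ... | no b∉K = contradiction (b , x∈p∧x∉q⇒x∈p─q b∈R b∉K , a , a∈K , a~b) no-edge-leaves
    ... | yes (b , b∈R─K , a , a∈K , a~b) =
      grow K′ (smaller ∣R─K′∣<∣R─K∣) K′⊆R (p⊆p∪q _ x∈K) K′-to-x
      where
      K′ : Subset n
      K′ = K ∪ ⁅ b ⁆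
      ∣R─K′∣<∣R─K∣ : ∣ R ─ K′ ∣ < ∣ R ─ K ∣
      ∣R─K′∣<∣R─K∣ = subst (λ X → ∣ X ∣ < ∣ R ─ K ∣) (p─q─r≡p─q∪r R K ⁅ b ⁆) (x∈p⇒∣p-x∣<∣p∣ b∈R─K)
      K′⊆R : K′ ⊆ R
      K′⊆R y∈K′ with x∈p∪q⁻ K ⁅ b ⁆ y∈K′
      ... | inj₁ y∈K = K⊆R y∈K
      ... | inj₂ y∈⁅b⁆ = subst (_∈ R) (≡.sym (x∈⁅y⁆⇒x≡y b y∈⁅b⁆)) (p─q⊆p R K b∈R─K)
      K′-to-x : ∀ {y} → y ∈ K′ → WalkIn G (_∈ K′) y x
      K′-to-x y∈K′ with x∈p∪q⁻ K ⁅ b ⁆ y∈K′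
      ... | inj₁ y∈K = walk-map (p⊆p∪q _) (to-x y∈K)
      ... | inj₂ y∈⁅b⁆ with x∈⁅y⁆⇒x≡y b y∈⁅b⁆
      ...   | refl = step y∈K′ (~-sym a~b) (walk-map (p⊆p∪q _) (to-x a∈K))

  component-in : ∀ {U R K} → R ⊆ U → Closed U R → Component R K → Component U K
  component-in R⊆U R-closed K-comp = record
    { root = root ; root∈K = root∈K ; K⊆U = R⊆U ∘ K⊆U ; to-root = to-root
    ; closed = λ a∈K b∈U a~b → closed a∈K (R-closed (K⊆U a∈K) b∈U a~b) a~b }
    where open Component K-comp

  module IntervalModels (k : ℕ) where

    InBag : Subset n → Subset n → (Fin n → ℕ) → (Fin n → ℕ) → ℕ → Fin n → Set
    InBag E D start end t x = x ∈ E ⊎ (x ∈ D × start x ≤ t × t ≤ end x)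

    -- A path decomposition of G[D] with bags 0, …, len - 1, where x occupies the bags
    -- start x, …, end x, and where every bag also contains E (the vertices placed above D).
    record IntervalModel (E D : Subset n) (len : ℕ) : Set where
      field
        start end  : Fin n → ℕ
        start≤end  : ∀ {x} → x ∈ D → start x ≤ end x
        end<len    : ∀ {x} → x ∈ D → end x < len
        edge-meets : ∀ {x y} → x ∈ D → y ∈ D → x ~ y → start x ≤ end y
        bag-α≤     : ∀ t → α≤ (InBag E D start end t) k

    Model : Subset n → Subset n → Set
    Model E D = ∃ (IntervalModel E D)

    weaken : ∀ {E E′ D} → E ⊆ E′ → Model E′ D → Model E D
    weaken E⊆E′ (len , M) = len , record
      { IntervalModel M
      ; bag-α≤ = λ t → α≤-mono (map₁ E⊆E′) ≤-refl (bag-α≤ t) }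
      where open IntervalModel M

    empty-model : ∀ {E D} → Empty D → α≤ (_∈ E) k → Model E D
    empty-model {E} {D} D-empty α≤E = 0 , record
      { start = λ _ → 0 ; end = λ _ → 0
      ; start≤end = λ _ → z≤n
      ; end<len = λ x∈D → contradiction (_ , x∈D) D-empty
      ; edge-meets = λ _ _ _ → z≤n
      ; bag-α≤ = λ t → α≤-mono only-E ≤-refl α≤E }
      where
      only-E : ∀ {x t} → InBag E D (λ _ → 0) (λ _ → 0) t x → x ∈ E
      only-E (inj₁ x∈E) = x∈E
      only-E (inj₂ (x∈D , _)) = contradiction (_ , x∈D) D-empty

    concat : ∀ {E D K} → Closed D K → Model E K → Model E (D ─ K) → Model E D
    concat {E} {D} {K} K-closed (l₁ , M₁) (l₂ , M₂) = l₁ + l₂ , record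
      { start = start ; end = end ; start≤end = start≤end ; end<len = end<len
      ; edge-meets = edge-meets ; bag-α≤ = bag-α≤ }
      where
      module M₁ = IntervalModel M₁
      module M₂ = IntervalModel M₂
      start end : Fin n → ℕ
      start x = if does (x ∈? K) then M₁.start x else l₁ + M₂.start x
      end x = if does (x ∈? K) then M₁.end x else l₁ + M₂.end x

      side : ∀ {x} → x ∈ D →
             (x ∈ K × start x ≡ M₁.start x × end x ≡ M₁.end x) ⊎
             (x ∈ D ─ K × start x ≡ l₁ + M₂.start x × end x ≡ l₁ + M₂.end x)
      side {x} x∈D with x ∈? K
      ... | yes x∈K = inj₁ (x∈K , refl , refl)
      ... | no x∉K = inj₂ (x∈p∧x∉q⇒x∈p─q x∈D x∉K , refl , refl)

      start≤end : ∀ {x} → x ∈ D → start x ≤ end x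
      start≤end x∈D with side x∈D
      ... | inj₁ (x∈K , s , e) rewrite s | e = M₁.start≤end x∈K
      ... | inj₂ (x∈D─K , s , e) rewrite s | e = +-monoʳ-≤ l₁ (M₂.start≤end x∈D─K)

      end<len : ∀ {x} → x ∈ D → end x < l₁ + l₂
      end<len x∈D with side x∈D
      ... | inj₁ (x∈K , _ , e) rewrite e = <-≤-trans (M₁.end<len x∈K) (m≤m+n l₁ l₂)
      ... | inj₂ (x∈D─K , _ , e) rewrite e = +-monoʳ-< l₁ (M₂.end<len x∈D─K)

      edge-meets : ∀ {x y} → x ∈ D → y ∈ D → x ~ y → start x ≤ end y
      edge-meets x∈D y∈D x~y with side x∈D | side y∈D
      ... | inj₁ (x∈K , s , _) | inj₁ (y∈K , _ , e) rewrite s | e = M₁.edge-meets x∈K y∈K x~y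
      ... | inj₁ (x∈K , _ , _) | inj₂ (y∈D─K , _ , _) =
        contradiction (K-closed x∈K y∈D x~y) (proj₂ (x∈p─q⁻ D K y∈D─K))
      ... | inj₂ (x∈D─K , _ , _) | inj₁ (y∈K , _ , _) =
        contradiction (K-closed y∈K x∈D (~-sym x~y)) (proj₂ (x∈p─q⁻ D K x∈D─K))
      ... | inj₂ (x∈D─K , s , _) | inj₂ (y∈D─K , _ , e) rewrite s | e =
        +-monoʳ-≤ l₁ (M₂.edge-meets x∈D─K y∈D─K x~y)

      bag-α≤ : ∀ t → α≤ (InBag E D start end t) k
      bag-α≤ t with t <? l₁
      ... | yes t<l₁ = α≤-mono early ≤-refl (M₁.bag-α≤ t)
        where
        early : ∀ {x} → InBag E D start end t x → InBag E K M₁.start M₁.end t x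
        early (inj₁ x∈E) = inj₁ x∈E
        early (inj₂ (x∈D , s≤t , t≤e)) with side x∈D
        ... | inj₁ (x∈K , s , e) rewrite s | e = inj₂ (x∈K , s≤t , t≤e)
        ... | inj₂ (_ , s , _) rewrite s = contradiction (m+n≤o⇒m≤o l₁ s≤t) (<⇒≱ t<l₁)
      ... | no t≮l₁ with m≤n⇒∃[o]m+o≡n (≮⇒≥ t≮l₁)
      ...   | t′ , refl = α≤-mono late ≤-refl (M₂.bag-α≤ t′)
        where
        late : ∀ {x} → InBag E D start end (l₁ + t′) x → InBag E (D ─ K) M₂.start M₂.end t′ x
        late (inj₁ x∈E) = inj₁ x∈E
        late (inj₂ (x∈D , s≤t , t≤e)) with side x∈D
        ... | inj₁ (x∈K , _ , e) rewrite e =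
          contradiction (≤-trans (m≤m+n l₁ t′) t≤e) (<⇒≱ (M₁.end<len x∈K))
        ... | inj₂ (x∈D─K , s , e) rewrite s | e =
          inj₂ (x∈D─K , +-cancelˡ-≤ l₁ _ _ s≤t , +-cancelˡ-≤ l₁ _ _ t≤e)

    add-spanning : ∀ {E D} (W : Subset n) → W ⊆ E → Model E (D ─ W) → Model E D
    add-spanning {E} {D} W W⊆E (l , M) = suc l , record
      { start = start ; end = end ; start≤end = start≤end ; end<len = end<len
      ; edge-meets = edge-meets ; bag-α≤ = bag-α≤ }
      where
      module M = IntervalModel M
      start end : Fin n → ℕ
      start x = if does (x ∈? W) then 0 else suc (M.start x)
      end x = if does (x ∈? W) then l else suc (M.end x)

      side : ∀ {x} → x ∈ D →
             (x ∈ W × start x ≡ 0 × end x ≡ l) ⊎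
             (x ∈ D ─ W × start x ≡ suc (M.start x) × end x ≡ suc (M.end x))
      side {x} x∈D with x ∈? W
      ... | yes x∈W = inj₁ (x∈W , refl , refl)
      ... | no x∉W = inj₂ (x∈p∧x∉q⇒x∈p─q x∈D x∉W , refl , refl)

      start≤end : ∀ {x} → x ∈ D → start x ≤ end x
      start≤end x∈D with side x∈D
      ... | inj₁ (_ , s , _) rewrite s = z≤n
      ... | inj₂ (x∈D─W , s , e) rewrite s | e = s≤s (M.start≤end x∈D─W)

      end<len : ∀ {x} → x ∈ D → end x < suc l
      end<len x∈D with side x∈D
      ... | inj₁ (_ , _ , e) rewrite e = n<1+n l
      ... | inj₂ (x∈D─W , _ , e) rewrite e = s≤s (M.end<len x∈D─W)

      edge-meets : ∀ {x y} → x ∈ D → y ∈ D → x ~ y → start x ≤ end y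
      edge-meets x∈D y∈D x~y with side x∈D | side y∈D
      ... | inj₁ (_ , s , _) | _ rewrite s = z≤n
      ... | inj₂ (x∈D─W , s , _) | inj₁ (_ , _ , e) rewrite s | e =
        ≤-<-trans (M.start≤end x∈D─W) (M.end<len x∈D─W)
      ... | inj₂ (x∈D─W , s , _) | inj₂ (y∈D─W , _ , e) rewrite s | e =
        s≤s (M.edge-meets x∈D─W y∈D─W x~y)

      bag-α≤ : ∀ t → α≤ (InBag E D start end t) k
      bag-α≤ t = α≤-mono shifted ≤-refl (M.bag-α≤ (pred t))
        where
        shifted : ∀ {x} → InBag E D start end t x → InBag E (D ─ W) M.start M.end (pred t) x
        shifted (inj₁ x∈E) = inj₁ x∈E
        shifted (inj₂ (x∈D , s≤t , t≤e)) with side x∈D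
        ... | inj₁ (x∈W , _ , _) = inj₁ (W⊆E x∈W)
        ... | inj₂ (x∈D─W , s , e) rewrite s | e = inj₂ (x∈D─W , <⇒≤pred s≤t , pred-mono-≤ t≤e)

    by-components : ∀ {E U} → α≤ (_∈ E) k → (∀ {K} → Component U K → Model E K) →
                    ∀ {R} → R ⊆ U → Closed U R → Model E R
    by-components {E} {U} α≤E model-of-component {R} = go R (<-wellFounded ∣ R ∣)
      where
      go : ∀ R → Acc _<_ ∣ R ∣ → R ⊆ U → Closed U R → Model E R
      go R (acc smaller) R⊆U R-closed with nonempty? R
      ... | no R-empty = empty-model R-empty α≤E
      ... | yes (_ , x∈R) with component x∈R
      ...   | K , K-comp = concat closed (model-of-component (component-in R⊆U R-closed K-comp))
                             (go (R ─ K) (smaller ∣R─K∣<∣R∣) (R⊆U ∘ p─q⊆p R K) rest-closed)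
        where
        open Component K-comp
        ∣R─K∣<∣R∣ : ∣ R ─ K ∣ < ∣ R ∣
        ∣R─K∣<∣R∣ = p∩q≢∅⇒∣p─q∣<∣p∣ R K (root , x∈p∩q⁺ (K⊆U root∈K , root∈K))
        rest-closed : Closed U (R ─ K)
        rest-closed a∈R─K b∈U a~b with x∈p─q⁻ R K a∈R─K
        ... | a∈R , a∉K = x∈p∧x∉q⇒x∈p─q b∈R (λ b∈K → a∉K (closed b∈K a∈R (~-sym a~b)))
          where b∈R = R-closed a∈R b∈U a~b

    tree-decomposition : ∀ {E} → Model E 𝕍 → TreeAlphaAtMost G k
    tree-decomposition (len , M) =
      decomposition , λ t → α≤-mono (λ x∈β → inj₂ (∈⊤ , ∈β⁻ x∈β)) ≤-refl (bag-α≤ (toℕ t))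
      where
      open IntervalModel M
      β′ : Fin (suc len) → Subset n
      β′ t = tabulate (λ x → (start x ≤ᵇ toℕ t) ∧ (toℕ t ≤ᵇ end x))
      ∈β⁺ : ∀ {x t} → start x ≤ toℕ t → toℕ t ≤ end x → x ∈ β′ t
      ∈β⁺ s≤t t≤e =
        ∈-tabulate⁺ (Equivalence.to Boolₚ.T-≡ (Equivalence.from Boolₚ.T-∧ (≤⇒≤ᵇ s≤t , ≤⇒≤ᵇ t≤e)))
      ∈β⁻ : ∀ {x t} → x ∈ β′ t → start x ≤ toℕ t × toℕ t ≤ end x
      ∈β⁻ {x} {t} x∈β with Equivalence.to Boolₚ.T-∧ (Equivalence.from Boolₚ.T-≡ (∈-tabulate⁻ x∈β))
      ... | s≤ᵇt , t≤ᵇe = ≤ᵇ⇒≤ (start x) (toℕ t) s≤ᵇt , ≤ᵇ⇒≤ (toℕ t) (end x) t≤ᵇe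
      slot : ∀ {i} → i ≤ len → Fin (suc len)
      slot i≤len = fromℕ< (s≤s i≤len)
      ∈β-slot : ∀ {x i} (i≤len : i ≤ len) → start x ≤ i → i ≤ end x → x ∈ β′ (slot i≤len)
      ∈β-slot i≤len s≤i i≤e =
        ∈β⁺ (≤-trans s≤i (≤-reflexive (≡.sym slot≡i))) (≤-trans (≤-reflexive slot≡i) i≤e)
        where slot≡i = Finₚ.toℕ-fromℕ< (s≤s i≤len)
      end≤len : ∀ x → end x ≤ len
      end≤len x = <⇒≤ (end<len ∈⊤)
      decomposition : TreeDecomposition G
      decomposition = record
        { m = suc len ; T = path (suc len) ; isTree = path-isTree len ; β = β′
        ; cover = λ x → _ , ∈β-slot (≤-trans (start≤end ∈⊤) (end≤len x)) ≤-refl (start≤end ∈⊤)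
        ; edgeCov = λ u v u~v →
            let u-live = ⊔-lub (start≤end ∈⊤) (edge-meets ∈⊤ ∈⊤ (~-sym u~v))
                v-live = ⊔-lub (edge-meets ∈⊤ ∈⊤ u~v) (start≤end ∈⊤)
                i≤len = ≤-trans u-live (end≤len u)
            in _ , ∈β-slot i≤len (m≤m⊔n _ _) u-live , ∈β-slot i≤len (m≤n⊔m _ _) v-live
        ; subtree = λ v → convex⇒connected (λ t → v ∈ β′ t) λ i≤j j≤k v∈i v∈k →
            ∈β⁺ (≤-trans (proj₁ (∈β⁻ v∈i)) i≤j) (≤-trans j≤k (proj₂ (∈β⁻ v∈k)))
        }

  module _ {d s : ℕ} (2≤d : 2 ≤ d) (star-free : Free (star d) G) (path-free : Free (path s) G) where

    α≤-nbhd : ∀ p → α≤ (_∈ nbhd p) (d ∸ 1)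
    α≤-nbhd p S S⊆nbhd S-indep with d ≤? ∣ S ∣
    ... | no d≰∣S∣ = <⇒≤pred (≰⇒> d≰∣S∣)
    ... | yes d≤∣S∣ = ⊥-elim (star-free (f , injective , adjacency))
      where
      leaf : Fin d → Fin n
      leaf i = enumerate S (inject≤ i d≤∣S∣)
      leaf∈S : ∀ i → leaf i ∈ S
      leaf∈S i = enumerate-∈ S _
      p~leaf : ∀ i → p ~ leaf i
      p~leaf i = ∈-tabulate⁻ (S⊆nbhd (leaf∈S i))
      f : Fin (suc d) → Fin n
      f zero = p
      f (suc i) = leaf i
      injective : Injective _≡_ _≡_ f
      injective {zero} {zero} _ = refl
      injective {zero} {suc j} p≡leaf = ⊥-elim (~-irrefl (subst (p ~_) (≡.sym p≡leaf) (p~leaf j)))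
      injective {suc i} {zero} leaf≡p = ⊥-elim (~-irrefl (subst (p ~_) leaf≡p (p~leaf i)))
      injective {suc i} {suc j} e =
        cong suc (Finₚ.inject≤-injective _ _ i j (enumerate-injective S e))
      adjacency : ∀ i j → adj G (f i) (f j) ≡ adj (star d) i j
      adjacency zero zero = irrefl G p
      adjacency zero (suc j) = p~leaf j
      adjacency (suc i) zero = ~-sym (p~leaf i)
      adjacency (suc i) (suc j) = S-indep _ _ (leaf∈S i) (leaf∈S j)

    α≤-N[] : ∀ p → α≤ (_∈ N[ p ]) (d ∸ 1)
    α≤-N[] p S S⊆N[p] S-indep with p ∈? S
    ... | yes p∈S = ≤-trans (p⊆q⇒∣p∣≤∣q∣ S⊆⁅p⁆) (≤-trans (≤-reflexive (∣⁅x⁆∣≡1 p)) (<⇒≤pred 2≤d))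
      where
      S⊆⁅p⁆ : S ⊆ ⁅ p ⁆
      S⊆⁅p⁆ x∈S with ∈N[]⁻ (S⊆N[p] x∈S)
      ... | inj₁ refl = x∈⁅x⁆ p
      ... | inj₂ p~x = contradiction p~x (independent⇒≁ S-indep p∈S x∈S)
    ... | no p∉S = α≤-nbhd p S S⊆nbhd S-indep
      where
      S⊆nbhd : S ⊆ nbhd p
      S⊆nbhd x∈S with ∈N[]⁻ (S⊆N[p] x∈S)
      ... | inj₁ refl = contradiction x∈S p∉S
      ... | inj₂ p~x = ∈-tabulate⁺ p~x

    α≤-pathNbhd : ∀ {m} (q : Vector (Fin n) m) → α≤ (_∈ pathNbhd q) ((d ∸ 1) * m)
    α≤-pathNbhd {zero} q = α≤-mono id z≤n α≤-∅
    α≤-pathNbhd {suc m} q = α≤-mono id (≤-reflexive (≡.sym (*-suc (d ∸ 1) m)))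
      (α≤-∪ (α≤-N[] (q zero)) (α≤-pathNbhd (Vector.tail q)))

    record Anchored {m} (q : Vector (Fin n) (suc m)) (C : Subset n) : Set where
      field
        induced   : IsInducedPath q
        far       : ∀ {c} → c ∈ C → ∀ i → c ∉ N[ q (suc i) ]
        reachable : ∀ {c} → c ∈ C → ∃ λ z → z ∈ N[ q zero ] × WalkIn G (_∈ C) c z
        room      : 3 + m ≤ s

    module _ {m} {q : Vector (Fin n) (suc m)} {C K}
             (C-anchored : Anchored q C) (K-comp : Component (C ─ N[ q zero ]) K) where
      open Anchored C-anchored
      open Component K-comp

      private
        K⊆C : K ⊆ C
        K⊆C = p─q⊆p C _ ∘ K⊆U
        K∩N[q₀]≡∅ : ∀ {c} → c ∈ K → c ∉ N[ q zero ]
        K∩N[q₀]≡∅ c∈K = proj₂ (x∈p─q⁻ C _ (K⊆U c∈K))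

        attachment : ∃₂ λ w z → w ∈ C × q zero ~ w × z ~ w × WalkIn G (_∈ K) root z
        attachment with reachable (K⊆C root∈K)
        ... | _ , z′∈N , root-to-z′ with walk-exit N[ q zero ] (K∩N[q₀]≡∅ root∈K) z′∈N root-to-z′
        ...   | w , z , w∈N , w∈C , z~w , exit-walk = w , z , w∈C , q₀~w , z~w , root-to-z
          where
          root-to-z : WalkIn G (_∈ K) root z
          root-to-z = walk-stays closed root∈K
            (walk-map (λ (c∈C , c∉N) → x∈p∧x∉q⇒x∈p─q c∈C c∉N) exit-walk)
          q₀~w : q zero ~ w
          q₀~w with ∈N[]⁻ w∈N
          ... | inj₁ refl = contradiction (~⇒∈N[] (~-sym z~w)) (K∩N[q₀]≡∅ (walk-target root-to-z))
          ... | inj₂ q₀~w = q₀~w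

      branch : ∃ λ w → K ⊂ C × Anchored (w ◂ q) K
      branch with attachment
      ... | w , z , w∈C , q₀~w , z~w , root-to-z = w , (K⊆C , w , w∈C , w∉K) , record
        { induced = induced′ ; far = far′ ; reachable = reachable′ ; room = room′ }
        where
        w∉K : w ∉ K
        w∉K w∈K = K∩N[q₀]≡∅ w∈K (~⇒∈N[] q₀~w)
        induced′ : IsInducedPath (w ◂ q)
        induced′ = ◂-induced induced (~-sym q₀~w) (far w∈C)
        far′ : ∀ {c} → c ∈ K → ∀ i → c ∉ N[ (w ◂ q) (suc i) ]
        far′ c∈K zero = K∩N[q₀]≡∅ c∈K
        far′ c∈K (suc i) = far (K⊆C c∈K) i
        reachable′ : ∀ {c} → c ∈ K → ∃ λ z → z ∈ N[ w ] × WalkIn G (_∈ K) c z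
        reachable′ c∈K = z , ~⇒∈N[] (~-sym z~w) , to-root c∈K ++ʷ root-to-z
        room′ : 3 + suc m ≤ s
        room′ = ≰⇒> λ s≤3+m → path-free⇒longer-path-free {G = G} s≤3+m path-free
          (z ◂ w ◂ q , ◂-induced induced′ z~w (far′ (walk-target root-to-z)))

    open IntervalModels ((d ∸ 1) * (s ∸ 2))

    anchored-model : ∀ {m} {q : Vector (Fin n) (suc m)} {C} → Acc _<_ ∣ C ∣ → Anchored q C →
                     Model (pathNbhd q) C
    anchored-model {q = q} {C} (acc smaller) C-anchored =
      add-spanning N[ q zero ] (p⊆p∪q _)
        (by-components α≤-bags component-model ⊆-refl (λ _ b∈C─N[q₀] _ → b∈C─N[q₀]))
      where
      open Anchored C-anchored
      α≤-bags : α≤ (_∈ pathNbhd q) ((d ∸ 1) * (s ∸ 2))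
      α≤-bags = α≤-mono id (*-monoʳ-≤ (d ∸ 1) (∸-monoˡ-≤ 2 room)) (α≤-pathNbhd q)
      component-model : ∀ {K} → Component (C ─ N[ q zero ]) K → Model (pathNbhd q) K
      component-model K-comp with branch C-anchored K-comp
      ... | w , K⊂C , K-anchored =
        weaken (q⊆p∪q N[ w ] _) (anchored-model (smaller (p⊂q⇒∣p∣<∣q∣ K⊂C)) K-anchored)

    decomposition-model : 3 ≤ s → Model ∅ 𝕍
    decomposition-model 3≤s =
      by-components (α≤-mono id z≤n α≤-∅) component-model ⊆-refl (λ _ b∈𝕍 _ → b∈𝕍)
      where
      component-model : ∀ {K} → Component 𝕍 K → Model ∅ K
      component-model K-comp = weaken (λ x∈∅ → contradiction x∈∅ ∉⊥)
        (anchored-model {q = root ◂ Vector.[]} (<-wellFounded _) record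
          { induced = single-vertex-path root
          ; far = λ _ ()
          ; reachable = λ c∈K → root , p∈N[p] root , to-root c∈K
          ; room = 3≤s })
        where open Component K-comp

theorem1p5 : (d s : ℕ) → 2 ≤ d → 3 ≤ s → {n : ℕ} → (G : Graph n) →
    Free (star d) G → Free (path s) G →
    TreeAlphaAtMost G ((d ∸ 1) * (s ∸ 2))
theorem1p5 d s 2≤d 3≤s G star-free path-free =
  tree-decomposition (decomposition-model G 2≤d star-free path-free 3≤s)
  where open IntervalModels G ((d ∸ 1) * (s ∸ 2))
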